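{- Let $\langle S,T\rangle$ be a Rec program whose statement $S$ contains no statement variables, and let $\phi$ be a closed trace formula. If the judgment $S:\phi$ is valid, i.e. $\mathcal{S}_{tr}[\![S]\!]\subseteq[\![\phi]\!]$, then $\mathsf{stf}(S)\models\phi$, i.e. $[\![\mathsf{stf}(S)]\!]\subseteq[\![\phi]\!]$.
   Context: Rec programs: a pair $\langle S,T\rangle$ with $S ::= \mathbf{skip} \mid x := a \mid S_1;S_2 \mid \mathbf{if}\ b\ \mathbf{then}\ S_1\ \mathbf{else}\ S_2 \mid m()$ (possibly extended by statement variables $Y$, atomic statements interpreted by an interpretation; here none occur) and $T$ a finite list of declarations $m\,\{S_m\}$ of parameterless procedures with unique names; only declared procedures are called. $a$, $b$ are side-effect-free arithmetic/Boolean expressions over global integer variables; $\mathbf{State}$ = maps from variables to $\mathbb{Z}$; $\mathbf{State}^+$ = nonempty finite state sequences. Trace semantics: $A|_b=\{s\cdot\sigma\in A:\mathcal{B}[\![b]\!](s)=\mathbf{tt}\}$, $\sharp A=\{s\cdot s\cdot\sigma:s\cdot\sigma\in A\}$, $A\frown B=\{\sigma_A\cdot s\cdot\sigma_B:\sigma_A\cdot s\in A, s\cdot\sigma_B\in B\}$. With procedures $m_i\,\{S_i\}$ and $\rho$ mapping procedure names to trace sets: $\mathcal{S}_{tr}[\![\mathbf{skip}]\!]_\rho=\{s\cdot s\}$, $\mathcal{S}_{tr}[\![x:=a]\!]_\rho=\{s\cdot s[x\mapsto\mathcal{A}[\![a]\!](s)]\}$, sequencing is $\frown$, $\mathcal{S}_{tr}[\![\mathbf{if}\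 b\ \mathbf{then}\ S_1\ \mathbf{else}\ S_2]\!]_\rho=(\sharp\mathcal{S}_{tr}[\![S_1]\!]_\rho)|_b\cup(\sharp\mathcal{S}_{tr}[\![S_2]\!]_\rho)|_{\neg b}$, $\mathcal{S}_{tr}[\![m_i()]\!]_\rho=\rho(m_i)$; $\rho_0$ is the least fixed point of $\rho\mapsto(\sharp\mathcal{S}_{tr}[\![S_1]\!]_\rho,\dots,\sharp\mathcal{S}_{tr}[\![S_n]\!]_\rho)$, and $\mathcal{S}_{tr}[\![S]\!]=\mathcal{S}_{tr}[\![S]\!]_{\rho_0}$. Trace formulas: $\phi ::= p \mid R \mid X \mid \phi_1\wedge\phi_2 \mid \phi_1\vee\phi_2 \mid \phi_1\frown\phi_2 \mid \mu X.\phi$; $[\![p]\!]=\{s\cdot\sigma:s\models p\}$ for state formulas $p$ (including Boolean expressions), $[\![R]\!]=\{s\cdot s':R(s,s')\}$, $[\![X]\!]_{\mathcal{V}}=\mathcal{V}(X)$, $\wedge,\vee,\frown$ as intersection, union and chop of trace sets, $[\![\mu X.\phi]\!]_{\mathcal{V}}=\bigcap\{\gamma:[\![\phi]\!]_{\mathcal{V}[X\mapsto\gamma]}\subseteq\gamma\}$; closed formulas have valuation-independent semantics $[\![\phi]\!]$. $\mathit{Id}(s,s')$ iff $s'=s$; $\mathit{Sb}^a_x(s,s')$ iff $s'=s[x\mapsto\mathcal{A}[\![a]\!](s)]$. Strongest trace formula $\mathsf{stf}(S)=\mathsf{stf}_\varnothing(S)$ where $\mathsf{stf}_{\overline{X}}(\mathbf{skip})=\mathit{Id}$,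 $\mathsf{stf}_{\overline{X}}(x:=a)=\mathit{Sb}^a_x$, $\mathsf{stf}_{\overline{X}}(S_1;S_2)=\mathsf{stf}_{\overline{X}}(S_1)\frown\mathsf{stf}_{\overline{X}}(S_2)$, $\mathsf{stf}_{\overline{X}}(\mathbf{if}\ b\ \mathbf{then}\ S_1\ \mathbf{else}\ S_2)=(b\wedge(\mathit{Id}\frown\mathsf{stf}_{\overline{X}}(S_1)))\vee(\neg b\wedge(\mathit{Id}\frown\mathsf{stf}_{\overline{X}}(S_2)))$, $\mathsf{stf}_{\overline{X}}(m())=\mathit{Id}\frown\mu X_m.\,\mathsf{stf}_{\overline{X}\cup\{m\}}(S_m)$ if $m\notin\overline{X}$ and $m\,\{S_m\}\in T$, else $\mathit{Id}\frown X_m$. -}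

module Defs where

open import Level using (Level; Lift; 0ℓ; _⊔_) renaming (suc to lsuc)
open import Data.Nat as ℕ using (ℕ)
open import Data.Integer as ℤ using (ℤ)
open import Data.Fin as Fin using (Fin; toℕ)
open import Data.Bool using (Bool; true; false; if_then_else_; not; _∧_)
open import Data.List using (List; []; _∷_; _++_)
open import Data.List.NonEmpty as L⁺ using (List⁺; _∷_; _∷ʳ_) renaming (head to hd)
open import Data.Product using (Σ; ∃; _×_; _,_)
open import Data.Sum using (_⊎_)
open import Data.Empty using (⊥)
open import Relation.Binary.PropositionalEquality using (_≡_)
open import Relation.Nullary.Decidable using (⌊_⌋)
open import Relation.Nullary using (¬_)
open import Relation.Unary using (Pred; _⊆_; _∪_)

Var : Set
Var = ℕ

State : Set
State = Var → ℤ

_[_↦_] : State → Var → ℤ → State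
(s [ x ↦ v ]) y = if ⌊ x ℕ.≟ y ⌋ then v else s y

data AExp : Set where
  num  : ℤ → AExp
  var  : Var → AExp
  _⊕_  : AExp → AExp → AExp
  _⊖_  : AExp → AExp → AExp
  _⊗_  : AExp → AExp → AExp

data BExp : Set where
  btrue bfalse : BExp
  _≐_   : AExp → AExp → BExp
  _≤ᵇ_  : AExp → AExp → BExp
  bnot  : BExp → BExp
  _∧ᵇ_  : BExp → BExp → BExp

𝒜⟦_⟧ : AExp → State → ℤ
𝒜⟦ num k ⟧ s = k
𝒜⟦ var x ⟧ s = s x
𝒜⟦ a ⊕ b ⟧ s = 𝒜⟦ a ⟧ s ℤ.+ 𝒜⟦ b ⟧ s
𝒜⟦ a ⊖ b ⟧ s = 𝒜⟦ a ⟧ s ℤ.- 𝒜⟦ b ⟧ s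
𝒜⟦ a ⊗ b ⟧ s = 𝒜⟦ a ⟧ s ℤ.* 𝒜⟦ b ⟧ s

ℬ⟦_⟧ : BExp → State → Bool
ℬ⟦ btrue ⟧ s = true
ℬ⟦ bfalse ⟧ s = false
ℬ⟦ a ≐ b ⟧ s = ⌊ 𝒜⟦ a ⟧ s ℤ.≟ 𝒜⟦ b ⟧ s ⌋
ℬ⟦ a ≤ᵇ b ⟧ s = ⌊ 𝒜⟦ a ⟧ s ℤ.≤? 𝒜⟦ b ⟧ s ⌋
ℬ⟦ bnot b ⟧ s = not (ℬ⟦ b ⟧ s)
ℬ⟦ b ∧ᵇ c ⟧ s = ℬ⟦ b ⟧ s ∧ ℬ⟦ c ⟧ s

-- A program ⟨S,T⟩ is S : Stmt n together with T : Fin n → Stmt n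
-- (names unique, only declared procedures callable, by construction).
-- No statement variables / atomic statements occur.

data Stmt (n : ℕ) : Set where
  skip   : Stmt n
  _≔_    : Var → AExp → Stmt n
  _︔_    : Stmt n → Stmt n → Stmt n
  ifˢ_then_else_ : BExp → Stmt n → Stmt n → Stmt n
  call   : Fin n → Stmt n

Trace : Set
Trace = List⁺ State

_∣_ : ∀ {ℓ} → Pred Trace ℓ → (State → Bool) → Pred Trace ℓ
(A ∣ b) σ = A σ × b (hd σ) ≡ true

♯ : ∀ {ℓ} → Pred Trace ℓ → Pred Trace ℓ
♯ A σ' = ∃ λ (s : State) → ∃ λ (σ : List State) → σ' ≡ (s ∷ (s ∷ σ)) × A (s ∷ σ)

_⌢_ : ∀ {a b} → Pred Trace a → Pred Trace b → Pred Trace (a ⊔ b)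
(A ⌢ B) σ = ∃ λ (σA : List State) → ∃ λ (s : State) → ∃ λ (σB : List State) →
  L⁺.toList σ ≡ σA ++ (s ∷ σB) × A (σA ∷ʳ s) × B (s ∷ σB)

𝒮tr⟦_⟧ : ∀ {n ℓ} → Stmt n → (Fin n → Pred Trace ℓ) → Pred Trace ℓ
𝒮tr⟦_⟧ {ℓ = ℓ} skip ρ σ = Lift ℓ (∃ λ s → σ ≡ (s ∷ (s ∷ [])))
𝒮tr⟦_⟧ {ℓ = ℓ} (x ≔ a) ρ σ = Lift ℓ (∃ λ s → σ ≡ (s ∷ ((s [ x ↦ 𝒜⟦ a ⟧ s ]) ∷ [])))
𝒮tr⟦ S₁ ︔ S₂ ⟧ ρ = 𝒮tr⟦ S₁ ⟧ ρ ⌢ 𝒮tr⟦ S₂ ⟧ ρ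
𝒮tr⟦ ifˢ b then S₁ else S₂ ⟧ ρ =
  (♯ (𝒮tr⟦ S₁ ⟧ ρ) ∣ ℬ⟦ b ⟧) ∪ (♯ (𝒮tr⟦ S₂ ⟧ ρ) ∣ (λ s → not (ℬ⟦ b ⟧ s)))
𝒮tr⟦ call m ⟧ ρ = ρ m

-- ρ₀ : least fixed point of ρ ↦ (♯𝒮tr⟦S₁⟧ρ, …, ♯𝒮tr⟦Sₙ⟧ρ), i.e. the
-- (componentwise) intersection of all its pre-fixed points.
ρ₀ : ∀ {n} → (Fin n → Stmt n) → Fin n → Pred Trace (lsuc 0ℓ)
ρ₀ {n} T m σ =
  (ρ : Fin n → Pred Trace 0ℓ) → (∀ m' → ♯ (𝒮tr⟦ T m' ⟧ ρ) ⊆ ρ m') → ρ m σ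

𝒮tr : ∀ {n} → (Fin n → Stmt n) → Stmt n → Pred Trace (lsuc 0ℓ)
𝒮tr T S = 𝒮tr⟦ S ⟧ (ρ₀ T)

-- Trace formulas (state formulas p and relations R are given
-- semantically; formula variables are natural numbers)

FVar : Set
FVar = ℕ

data Formula : Set₁ where
  st   : (State → Set) → Formula
  rel  : (State → State → Set) → Formula
  fv   : FVar → Formula
  _∧ᶠ_ : Formula → Formula → Formula
  _∨ᶠ_ : Formula → Formula → Formula
  _⌢ᶠ_ : Formula → Formula → Formula
  μ    : FVar → Formula → Formula

data _∈FV_ : FVar → Formula → Set₁ where
  fv-var : ∀ {X} → X ∈FV fv X
  fv-∧ˡ : ∀ {X φ ψ} → X ∈FV φ → X ∈FV (φ ∧ᶠ ψ)
  fv-∧ʳ : ∀ {X φ ψ} → X ∈FV ψ → X ∈FV (φ ∧ᶠ ψ)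
  fv-∨ˡ : ∀ {X φ ψ} → X ∈FV φ → X ∈FV (φ ∨ᶠ ψ)
  fv-∨ʳ : ∀ {X φ ψ} → X ∈FV ψ → X ∈FV (φ ∨ᶠ ψ)
  fv-⌢ˡ : ∀ {X φ ψ} → X ∈FV φ → X ∈FV (φ ⌢ᶠ ψ)
  fv-⌢ʳ : ∀ {X φ ψ} → X ∈FV ψ → X ∈FV (φ ⌢ᶠ ψ)
  fv-μ  : ∀ {X Y φ} → ¬ (X ≡ Y) → X ∈FV φ → X ∈FV (μ Y φ)

Closed : Formula → Set₁
Closed φ = ∀ X → ¬ (X ∈FV φ)

Valuation : (ℓ : Level) → Set (lsuc ℓ)
Valuation ℓ = FVar → Pred Trace ℓ

_[_≔_]ᵛ : ∀ {ℓ} → Valuation ℓ → FVar → Pred Trace ℓ → Valuation ℓ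
(V [ X ≔ γ ]ᵛ) Y = if ⌊ X ℕ.≟ Y ⌋ then γ else V Y

⟦_⟧_ : ∀ {ℓ} → Formula → Valuation ℓ → Pred Trace (lsuc ℓ)
(⟦_⟧_ {ℓ} (st p) V) σ = Lift (lsuc ℓ) (p (hd σ))
(⟦_⟧_ {ℓ} (rel R) V) σ = Lift (lsuc ℓ) (∃ λ s → ∃ λ s' → σ ≡ (s ∷ (s' ∷ [])) × R s s')
(⟦_⟧_ {ℓ} (fv X) V) σ = Lift (lsuc ℓ) (V X σ)
(⟦ φ ∧ᶠ ψ ⟧ V) σ = (⟦ φ ⟧ V) σ × (⟦ ψ ⟧ V) σ
(⟦ φ ∨ᶠ ψ ⟧ V) σ = (⟦ φ ⟧ V) σ ⊎ (⟦ ψ ⟧ V) σ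
(⟦ φ ⌢ᶠ ψ ⟧ V) = (⟦ φ ⟧ V) ⌢ (⟦ ψ ⟧ V)
(⟦_⟧_ {ℓ} (μ X φ) V) σ = (γ : Pred Trace ℓ) → (⟦ φ ⟧ (V [ X ≔ γ ]ᵛ)) ⊆ γ → γ σ

-- semantics of closed formulas (valuation irrelevant; use the empty one)
⟦_⟧ᶜ : Formula → Pred Trace (lsuc 0ℓ)
⟦ φ ⟧ᶜ = ⟦ φ ⟧ (λ _ _ → ⊥)

Id : Formula
Id = rel (λ s s' → s' ≡ s)

Sb : Var → AExp → Formula
Sb x a = rel (λ s s' → s' ≡ s [ x ↦ 𝒜⟦ a ⟧ s ])

bform : BExp → Formula
bform b = st (λ s → ℬ⟦ b ⟧ s ≡ true)

¬bform : BExp → Formula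
¬bform b = st (λ s → not (ℬ⟦ b ⟧ s) ≡ true)

X_ : ∀ {n} → Fin n → FVar
X m = toℕ m

_∈ᵇ_ : ∀ {n} → Fin n → List (Fin n) → Bool
m ∈ᵇ [] = false
m ∈ᵇ (k ∷ ks) = ⌊ m Fin.≟ k ⌋ Data.Bool.∨ (m ∈ᵇ ks)
  where import Data.Bool

-- stf with fuel k; started with fuel n and X̄ = ∅, every expansion adds a
-- fresh name to X̄ and consumes one unit, so the fuel-0 branch is only
-- reached when X̄ already contains all n names (i.e. never for m ∉ X̄).
stf-aux : ∀ {n} → (Fin n → Stmt n) → ℕ → List (Fin n) → Stmt n → Formula
stf-aux T k Xs skip = Id
stf-aux T k Xs (x ≔ a) = Sb x a
stf-aux T k Xs (S₁ ︔ S₂) = stf-aux T k Xs S₁ ⌢ᶠ stf-aux T k Xs S₂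
stf-aux T k Xs (ifˢ b then S₁ else S₂) =
  (bform b ∧ᶠ (Id ⌢ᶠ stf-aux T k Xs S₁)) ∨ᶠ (¬bform b ∧ᶠ (Id ⌢ᶠ stf-aux T k Xs S₂))
stf-aux T k Xs (call m) with m ∈ᵇ Xs | k
... | true  | _     = Id ⌢ᶠ fv (X m)
... | false | ℕ.zero = Id ⌢ᶠ fv (X m)
... | false | ℕ.suc k' = Id ⌢ᶠ μ (X m) (stf-aux T k' (m ∷ Xs) (T m))

stf : ∀ {n} → (Fin n → Stmt n) → Stmt n → Formula
stf {n} T S = stf-aux T n [] S

{-# OPTIONS --safe #-}
-- The strongest trace formula is sound: ⟦ stf S ⟧ ⊆ 𝒮tr⟦ S ⟧, so validity of
-- S : φ transfers to stf S ⊨ φ for every φ.  Soundness is compositional in S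
-- except at procedure calls.  There, the μ X_m in stf (call m) is a least
-- pre-fixed point, so it lies below any γ that the body maps into itself;
-- taking γ = ♯⁻¹ (ρ m) for a pre-fixed point ρ of the procedure environment
-- shows stf (call m) ⊆ ρ m, and intersecting over all such ρ gives ρ₀ m.
module Submission where

open import Defs
open import Data.Fin using (Fin; toℕ)
open import Relation.Unary using (Pred; _⊆_)
open import Level using (Level; lift; lower; 0ℓ)
open import Data.Nat using (ℕ; zero; suc; _≟_)
open import Data.Fin.Properties using (toℕ-injective)
open import Data.Bool using (true; false)
open import Data.List using (List; []; _∷_)
open import Data.List.NonEmpty using (_∷_)
open import Data.Product using (_,_)
open import Data.Sum using (inj₁; inj₂)
open import Relation.Binary.PropositionalEquality using (refl)
open import Relation.Nullary using (yes; no)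

private
  variable
    ℓ : Level
    n : ℕ

-- The preimage of B under s·σ ↦ s·s·σ; thus ♯ A ⊆ B iff A ⊆ ♯⁻¹ B.
♯⁻¹ : Pred Trace ℓ → Pred Trace ℓ
♯⁻¹ B (s ∷ σ) = B (s ∷ s ∷ σ)

♯-mono : ∀ {a b} {A : Pred Trace a} {B : Pred Trace b} → A ⊆ B → ♯ A ⊆ ♯ B
♯-mono A⊆B (s , σ , refl , a) = s , σ , refl , A⊆B a

♯-♯⁻¹ : {B : Pred Trace ℓ} → ♯ (♯⁻¹ B) ⊆ B
♯-♯⁻¹ (s , σ , refl , b) = b

Id⌢⊆♯ : ∀ {a} {V : Valuation ℓ} {P : Pred Trace a} → (⟦ Id ⟧ V) ⌢ P ⊆ ♯ P
Id⌢⊆♯ ([] , _ , _ , _ , lift (_ , _ , () , _) , _)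
Id⌢⊆♯ (_ ∷ [] , s , σ , refl , lift (_ , _ , refl , refl) , p) = s , σ , refl , p
Id⌢⊆♯ (_ ∷ _ ∷ [] , _ , _ , _ , lift (_ , _ , () , _) , _)
Id⌢⊆♯ (_ ∷ _ ∷ _ ∷ _ , _ , _ , _ , lift (_ , _ , () , _) , _)

PreFixed : (Fin n → Stmt n) → (Fin n → Pred Trace ℓ) → Set ℓ
PreFixed T ρ = ∀ m → ♯ (𝒮tr⟦ T m ⟧ ρ) ⊆ ρ m

ρ₀-least : (T : Fin n → Stmt n) {ρ : Fin n → Pred Trace 0ℓ} →
  PreFixed T ρ → ∀ m → ρ₀ T m ⊆ ρ m
ρ₀-least T pf m σ∈ρ₀ = σ∈ρ₀ _ pf

-- The formula variable X m stands for the traces of the body of m, while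
-- ρ m holds the traces of a call, which repeat the entry state.
infix 4 _⊑_
_⊑_ : Valuation 0ℓ → (Fin n → Pred Trace ℓ) → Set ℓ
V ⊑ ρ = ∀ m → ♯ (V (X m)) ⊆ ρ m

⊑-weaken : ∀ {a b} {V : Valuation 0ℓ} {ρ : Fin n → Pred Trace a} {ρ' : Fin n → Pred Trace b} →
  (∀ m → ρ m ⊆ ρ' m) → V ⊑ ρ → V ⊑ ρ'
⊑-weaken ρ⊆ρ' V⊑ρ m σ∈V = ρ⊆ρ' m (V⊑ρ m σ∈V)

⊑-update : (V : Valuation 0ℓ) {ρ : Fin n → Pred Trace 0ℓ} (m : Fin n) →
  V ⊑ ρ → (V [ X m ≔ ♯⁻¹ (ρ m) ]ᵛ) ⊑ ρ
⊑-update V {ρ} m V⊑ρ m' with toℕ m ≟ toℕ m'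
... | yes m≡m' with toℕ-injective m≡m'
...   | refl = ♯-♯⁻¹ {B = ρ m}
⊑-update V m V⊑ρ m' | no _ = V⊑ρ m'

⟦Id⌢X⟧⊆ : (V : Valuation 0ℓ) {ρ : Fin n → Pred Trace ℓ} →
  V ⊑ ρ → ∀ m → ⟦ Id ⌢ᶠ fv (X m) ⟧ V ⊆ ρ m
⟦Id⌢X⟧⊆ V V⊑ρ m p = V⊑ρ m (♯-mono lower (Id⌢⊆♯ {V = V} p))

stf-aux⊆𝒮tr⟦⟧ : (T : Fin n → Stmt n) (k : ℕ) (Xs : List (Fin n))
  {V : Valuation 0ℓ} {ρ : Fin n → Pred Trace ℓ} →
  (∀ m → ⟦ stf-aux T k Xs (call m) ⟧ V ⊆ ρ m) →
  ∀ S → ⟦ stf-aux T k Xs S ⟧ V ⊆ 𝒮tr⟦ S ⟧ ρ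
stf-aux⊆𝒮tr⟦⟧ T k Xs {V} calls = go
  where
  go : ∀ S → ⟦ stf-aux T k Xs S ⟧ V ⊆ 𝒮tr⟦ S ⟧ _
  go skip (lift (s , _ , refl , refl)) = lift (s , refl)
  go (x ≔ a) (lift (s , _ , refl , refl)) = lift (s , refl)
  go (S₁ ︔ S₂) (σA , s , σB , split , p₁ , p₂) = σA , s , σB , split , go S₁ p₁ , go S₂ p₂
  go (ifˢ b then S₁ else S₂) (inj₁ (lift b-holds , p)) =
    inj₁ (♯-mono (go S₁) (Id⌢⊆♯ {V = V} p) , b-holds)
  go (ifˢ b then S₁ else S₂) (inj₂ (lift ¬b-holds , p)) =
    inj₂ (♯-mono (go S₂) (Id⌢⊆♯ {V = V} p) , ¬b-holds)
  go (call m) = calls m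

⟦stf-call⟧⊆PreFixed : (T : Fin n → Stmt n) {ρ : Fin n → Pred Trace 0ℓ} {V : Valuation 0ℓ} →
  PreFixed T ρ → V ⊑ ρ → ∀ k Xs m → ⟦ stf-aux T k Xs (call m) ⟧ V ⊆ ρ m
⟦stf-call⟧⊆PreFixed T {V = V} pf V⊑ρ zero Xs m with m ∈ᵇ Xs
... | true  = ⟦Id⌢X⟧⊆ V V⊑ρ m
... | false = ⟦Id⌢X⟧⊆ V V⊑ρ m
⟦stf-call⟧⊆PreFixed T {ρ} {V} pf V⊑ρ (suc k) Xs m with m ∈ᵇ Xs
... | true  = ⟦Id⌢X⟧⊆ V V⊑ρ m
... | false = λ p → ♯-♯⁻¹ {B = ρ m} (♯-mono μ⊆ (Id⌢⊆♯ {V = V} p))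
  where
  V' : Valuation 0ℓ
  V' = V [ X m ≔ ♯⁻¹ (ρ m) ]ᵛ

  body⊆ : ⟦ stf-aux T k (m ∷ Xs) (T m) ⟧ V' ⊆ ♯⁻¹ (ρ m)
  body⊆ {s ∷ σ} p = pf m (s , σ , refl ,
    stf-aux⊆𝒮tr⟦⟧ T k (m ∷ Xs) (⟦stf-call⟧⊆PreFixed T pf (⊑-update V m V⊑ρ) k (m ∷ Xs)) (T m) p)

  μ⊆ : ⟦ μ (X m) (stf-aux T k (m ∷ Xs) (T m)) ⟧ V ⊆ ♯⁻¹ (ρ m)
  μ⊆ σ∈μ = σ∈μ (♯⁻¹ (ρ m)) body⊆

⟦stf-call⟧⊆ρ₀ : (T : Fin n → Stmt n) {V : Valuation 0ℓ} →
  V ⊑ ρ₀ T → ∀ k Xs m → ⟦ stf-aux T k Xs (call m) ⟧ V ⊆ ρ₀ T m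
⟦stf-call⟧⊆ρ₀ T {V} V⊑ρ₀ k Xs m p ρ pf =
  ⟦stf-call⟧⊆PreFixed T pf (⊑-weaken {V = V} (ρ₀-least T pf) V⊑ρ₀) k Xs m p

⟦stf⟧⊆𝒮tr : ∀ (T : Fin n → Stmt n) S → ⟦ stf T S ⟧ᶜ ⊆ 𝒮tr T S
⟦stf⟧⊆𝒮tr {n} T = stf-aux⊆𝒮tr⟦⟧ T n [] (⟦stf-call⟧⊆ρ₀ T (λ _ ()) n [])

mainTheorem4 : ∀ {n} (T : Fin n → Stmt n) (S : Stmt n) (φ : Formula) →
    Closed φ → 𝒮tr T S ⊆ ⟦ φ ⟧ᶜ → ⟦ stf T S ⟧ᶜ ⊆ ⟦ φ ⟧ᶜ
mainTheorem4 T S φ _ valid σ∈stf = valid (⟦stf⟧⊆𝒮tr T S σ∈stf)
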